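{- Let $4\leq k\leq\ell$ and $N$ be integers and let $\{y_0<y_1<\dots<y_\ell\}\subseteq[2^N]$. Suppose that (a) $\{y_1,y_2,y_\ell\}$ forms a right comb, and (b) for every $J\in\{2,\dots,\ell\}^{(k-1)}$ there is a leaf $y_J$ with $y_0\leq y_J\leq y_1$ such that $\{y_J\}\cup\{y_j:j\in J\}$ does not form a $(1,k-1)$-split. Then $\{y_0,y_2,y_3,\dots,y_\ell\}$ forms a right comb.
   Context: Identify each $x\in[2^N]$ with the binary string of length $N$ representing $x-1$; these are the leaves, in left-to-right order, of the complete binary tree $T(N)$ with levels $1$ (root) to $N+1$ (leaves). For distinct leaves $x,y$, $a(x,y)$ is their greatest common ancestor (longest common prefix) and $\delta(x,y)$ its level (one plus the length of the longest common prefix). For a set $X$ of at least two leaves let $u_X=a(\min X,\max X)$ and let $X_L(u_X)$ (resp. $X_R(u_X)$) be the elements of $X$ in the subtree of the left (resp. right) child of $u_X$. For $X=\{x_1<\dots<x_s\}$ with $s\geq 3$, $X$ is a left comb if $\delta(x_1,x_2)>\dots>\delta(x_{s-1},x_s)$, a right comb if $\delta(x_1,x_2)<\dots<\delta(x_{s-1},x_s)$; if it is neither, it forms an $(\ell',r)$-split with $\ell'=|X_L(u_X)|$, $r=|X_R(u_X)|$. -}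

module Defs where

open import Data.Bool using (Bool; true; false; if_then_else_; _∧_; not)
open import Data.Nat using (ℕ; zero; suc; _+_; _∸_; _^_; _≤_; _<_; _>_; _≡ᵇ_)
open import Data.Nat.DivMod using (_/_; _%_)
open import Data.List using (List; []; _∷_; _++_; [_]; length; filter; map)
open import Data.List.Relation.Unary.Linked using (Linked)
open import Data.Product using (_×_)
open import Relation.Nullary using (¬_)
open import Relation.Binary.PropositionalEquality using (_≡_)

-- Binary string of length N of n (most significant bit first), n < 2^N.
bits : ℕ → ℕ → List Bool
bits zero    n = []
bits (suc N) n = bits N (n / 2) ++ [ n % 2 ≡ᵇ 1 ]

-- Leaf x ∈ [2^N] is identified with the binary string of length N of x - 1.
leafStr : ℕ → ℕ → List Bool
leafStr N x = bits N (x ∸ 1)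

eqB : Bool → Bool → Bool
eqB true  true  = true
eqB false false = true
eqB _     _     = false

lcp : List Bool → List Bool → List Bool
lcp (a ∷ as) (b ∷ bs) = if eqB a b then a ∷ lcp as bs else []
lcp _        _        = []

isPrefix : List Bool → List Bool → Bool
isPrefix []       _        = true
isPrefix (a ∷ as) []       = false
isPrefix (a ∷ as) (b ∷ bs) = eqB a b ∧ isPrefix as bs

-- greatest common ancestor a(x,y) (as a node = prefix) and its level δ(x,y)
gca : ℕ → ℕ → ℕ → List Bool
gca N x y = lcp (leafStr N x) (leafStr N y)

δ : ℕ → ℕ → ℕ → ℕ
δ N x y = suc (length (gca N x y))

-- A finite set of leaves X = {x₁ < … < x_s} is represented by the strictly
-- increasing list x₁ ∷ … ∷ x_s ∷ [].
deltas : ℕ → List ℕ → List ℕ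
deltas N (x ∷ y ∷ rest) = δ N x y ∷ deltas N (y ∷ rest)
deltas N _              = []

LeftComb : ℕ → List ℕ → Set
LeftComb N X = 3 ≤ length X × Linked _>_ (deltas N X)

RightComb : ℕ → List ℕ → Set
RightComb N X = 3 ≤ length X × Linked _<_ (deltas N X)

headD : List ℕ → ℕ
headD []      = 0
headD (x ∷ _) = x

lastD : List ℕ → ℕ
lastD []           = 0
lastD (x ∷ [])     = x
lastD (x ∷ y ∷ xs) = lastD (y ∷ xs)

uX : ℕ → List ℕ → List Bool
uX N X = gca N (headD X) (lastD X)

countIf : (ℕ → Bool) → List ℕ → ℕ
countIf p []       = 0
countIf p (x ∷ xs) = if p x then suc (countIf p xs) else countIf p xs

sizeXL : ℕ → List ℕ → ℕ
sizeXL N X = countIf (λ x → isPrefix (uX N X ++ [ false ]) (leafStr N x)) X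

sizeXR : ℕ → List ℕ → ℕ
sizeXR N X = countIf (λ x → isPrefix (uX N X ++ [ true ]) (leafStr N x)) X

Split : ℕ → ℕ → ℕ → List ℕ → Set
Split N l' r X = 3 ≤ length X × ¬ LeftComb N X × ¬ RightComb N X
               × sizeXL N X ≡ l' × sizeXR N X ≡ r

{-# OPTIONS --safe #-}
-- Increasing leaves have lexicographically increasing strings, so the common prefix of y_i and y_j
-- can only lengthen as [i, j] shrinks.  With (a) this gives δ(y₀,y₂) ≤ δ(y₁,y₂) < δ(y₂,y_ℓ) ≤ δ(y₂,y₃),
-- and for every z ∈ [y₀, y₁] and 2 ≤ j < j′ ≤ ℓ the common prefix of z and y_j is strictly shorter
-- than that of y_j and y_j′.  So for such z and increasing y_J, z is alone below the left child of u
-- and δ(z, y_j) < δ(y_j, y_j′): z ∪ y_J is a (1, |J|)-split as soon as y_J is not a right comb.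
-- If δ(y_i, y_{i+1}) ≥ δ(y_{i+1}, y_{i+2}) for some 2 ≤ i ≤ ℓ − 2, a block J of k − 1 consecutive indices
-- in {2, …, ℓ} containing i, i + 1, i + 2 therefore contradicts (b).
module Submission where

open import Defs
open import Data.Nat using (ℕ; _∸_; _^_; _≤_; _<_; suc; _+_)
open import Data.List using (List; []; _∷_; length; map; upTo)
open import Data.List.Relation.Unary.Linked using (Linked)
open import Data.List.Relation.Unary.All using (All)
open import Data.Product using (_×_; ∃-syntax)
open import Relation.Nullary using (¬_)
open import Relation.Binary.PropositionalEquality using (_≡_)

open import Data.Bool using (Bool; true; false; not)
open import Data.List using (_++_; [_]; applyUpTo)
open import Data.List.Properties using (length-applyUpTo; map-applyUpTo; map-upTo)
open import Data.List.Relation.Unary.All.Properties using (applyUpTo⁺₁)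
open import Data.Nat using (zero; z≤n; s≤s; s≤s⁻¹; s<s⁻¹; _*_; _<?_; _≤?_)
open import Data.Nat.DivMod using (_/_; _%_; m≡m%n+[m/n]*n; m%n<n; /-monoˡ-≤; m<n*o⇒m/o<n)
open import Data.Nat.Properties
open import Data.Product using (_,_; proj₁; proj₂)
open import Data.Sum using (inj₁; inj₂)
open import Function using (_∘_)
open import Relation.Nullary using (yes; no)
open import Relation.Nullary.Decidable using (decidable-stable)
open import Relation.Binary.PropositionalEquality using (refl; sym; trans; cong; subst)

infix 4 _≺_

data _≺_ : List Bool → List Bool → Set where
  here  : ∀ {a b} → false ∷ a ≺ true ∷ b
  there : ∀ {c a b} → a ≺ b → c ∷ a ≺ c ∷ b

∣lcp∣ : List Bool → List Bool → ℕ
∣lcp∣ a b = length (lcp a b)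

-- The shared bit c of 'there' is split on so that eqB c c, hence lcp, computes.
∣lcp∣-≺-outerˡ : ∀ {x y z} → x ≺ y → y ≺ z → ∣lcp∣ x z ≤ ∣lcp∣ x y
∣lcp∣-≺-outerˡ here              (there _) = z≤n
∣lcp∣-≺-outerˡ (there {false} _) here      = z≤n
∣lcp∣-≺-outerˡ (there {false} p) (there q) = s≤s (∣lcp∣-≺-outerˡ p q)
∣lcp∣-≺-outerˡ (there {true}  p) (there q) = s≤s (∣lcp∣-≺-outerˡ p q)

∣lcp∣-≺-outerʳ : ∀ {x y z} → x ≺ y → y ≺ z → ∣lcp∣ x z ≤ ∣lcp∣ y z
∣lcp∣-≺-outerʳ here              (there _) = z≤n
∣lcp∣-≺-outerʳ (there {false} _) here      = z≤n
∣lcp∣-≺-outerʳ (there {false} p) (there q) = s≤s (∣lcp∣-≺-outerʳ p q)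
∣lcp∣-≺-outerʳ (there {true}  p) (there q) = s≤s (∣lcp∣-≺-outerʳ p q)

isPrefix-∷ʳ-exclusive : ∀ p b s → isPrefix (p ++ [ b ]) s ≡ true →
                        isPrefix (p ++ [ not b ]) s ≡ false
isPrefix-∷ʳ-exclusive []          false (false ∷ _) _ = refl
isPrefix-∷ʳ-exclusive []          true  (true  ∷ _) _ = refl
isPrefix-∷ʳ-exclusive []          false (true  ∷ _) ()
isPrefix-∷ʳ-exclusive []          true  (false ∷ _) ()
isPrefix-∷ʳ-exclusive []          _     []          ()
isPrefix-∷ʳ-exclusive (_ ∷ _)     _     []          ()
isPrefix-∷ʳ-exclusive (false ∷ p) b     (false ∷ s) h = isPrefix-∷ʳ-exclusive p b s h
isPrefix-∷ʳ-exclusive (true  ∷ p) b     (true  ∷ s) h = isPrefix-∷ʳ-exclusive p b s h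
isPrefix-∷ʳ-exclusive (false ∷ _) _     (true  ∷ _) ()
isPrefix-∷ʳ-exclusive (true  ∷ _) _     (false ∷ _) ()

≺⇒left-of-lcp : ∀ {x e} → x ≺ e → isPrefix (lcp x e ++ [ false ]) x ≡ true
≺⇒left-of-lcp here              = refl
≺⇒left-of-lcp (there {false} p) = ≺⇒left-of-lcp p
≺⇒left-of-lcp (there {true}  p) = ≺⇒left-of-lcp p

≺⇒right-of-lcp : ∀ {x e} → x ≺ e → isPrefix (lcp x e ++ [ true ]) e ≡ true
≺⇒right-of-lcp here              = refl
≺⇒right-of-lcp (there {false} p) = ≺⇒right-of-lcp p
≺⇒right-of-lcp (there {true}  p) = ≺⇒right-of-lcp p

≺-between⇒right-of-lcp : ∀ {x y e} → x ≺ y → y ≺ e → ∣lcp∣ x y < ∣lcp∣ y e →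
                         isPrefix (lcp x e ++ [ true ]) y ≡ true
≺-between⇒right-of-lcp here              (there _) _         = refl
≺-between⇒right-of-lcp (there {false} _) here      ()
≺-between⇒right-of-lcp (there {false} p) (there q) (s≤s lt) = ≺-between⇒right-of-lcp p q lt
≺-between⇒right-of-lcp (there {true}  p) (there q) (s≤s lt) = ≺-between⇒right-of-lcp p q lt

≺-∷ʳ : ∀ {a b} c d → a ≺ b → a ++ [ c ] ≺ b ++ [ d ]
≺-∷ʳ c d here      = here
≺-∷ʳ c d (there p) = there (≺-∷ʳ c d p)

∷ʳ-false≺∷ʳ-true : ∀ p → p ++ [ false ] ≺ p ++ [ true ]
∷ʳ-false≺∷ʳ-true []      = here
∷ʳ-false≺∷ʳ-true (_ ∷ p) = there (∷ʳ-false≺∷ʳ-true p)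

<-below-2 : ∀ {a b} → a < b → b < 2 → a ≡ 0 × b ≡ 1
<-below-2 {0}     {1}           _       _                = refl , refl
<-below-2 {0}     {suc (suc _)} _       (s≤s (s≤s ()))
<-below-2 {suc _} {1}           (s≤s ()) _
<-below-2 {suc _} {suc (suc _)} _       (s≤s (s≤s ()))

%2-< : ∀ {x y} → x < y → x / 2 ≡ y / 2 → x % 2 < y % 2
%2-< {x} {y} x<y eq = +-cancelʳ-< (y / 2 * 2) (x % 2) (y % 2) (begin-strict
  x % 2 + y / 2 * 2 ≡⟨ cong (λ q → x % 2 + q * 2) eq ⟨
  x % 2 + x / 2 * 2 ≡⟨ m≡m%n+[m/n]*n x 2 ⟨
  x                 <⟨ x<y ⟩
  y                 ≡⟨ m≡m%n+[m/n]*n y 2 ⟩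
  y % 2 + y / 2 * 2 ∎)
  where open ≤-Reasoning

bits-mono : ∀ N {x y} → x < y → y < 2 ^ N → bits N x ≺ bits N y
bits-mono zero    {y = zero}  () _
bits-mono zero    {y = suc _} _  (s≤s ())
bits-mono (suc N) {y = y} x<y y<2^N+1 with m≤n⇒m<n∨m≡n (/-monoˡ-≤ 2 (<⇒≤ x<y))
... | inj₁ x/2<y/2 =
  ≺-∷ʳ _ _ (bits-mono N x/2<y/2 (m<n*o⇒m/o<n (subst (y <_) (*-comm 2 (2 ^ N)) y<2^N+1)))
... | inj₂ x/2≡y/2 with <-below-2 (%2-< x<y x/2≡y/2) (m%n<n y 2)
...   | x%2≡0 , y%2≡1 rewrite x/2≡y/2 | x%2≡0 | y%2≡1 = ∷ʳ-false≺∷ʳ-true (bits N (y / 2))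

leafStr-mono : ∀ N {x y} → 1 ≤ x → x < y → y ≤ 2 ^ N → leafStr N x ≺ leafStr N y
leafStr-mono N {suc x} {suc y} _ (s≤s x<y) y≤2^N = bits-mono N x<y y≤2^N

countIf-∷-true : ∀ p x xs → p x ≡ true → countIf p (x ∷ xs) ≡ suc (countIf p xs)
countIf-∷-true _ _ _ px rewrite px = refl

countIf-∷-false : ∀ p x xs → p x ≡ false → countIf p (x ∷ xs) ≡ countIf p xs
countIf-∷-false _ _ _ px rewrite px = refl

countIf-none : ∀ p {xs} → All (λ v → p v ≡ false) xs → countIf p xs ≡ 0
countIf-none p All.[]                  = refl
countIf-none p {x ∷ xs} (px All.∷ pxs) = trans (countIf-∷-false p x xs px) (countIf-none p pxs)

countIf-all : ∀ p {xs} → All (λ v → p v ≡ true) xs → countIf p xs ≡ length xs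
countIf-all p All.[]                  = refl
countIf-all p {x ∷ xs} (px All.∷ pxs) = trans (countIf-∷-true p x xs px) (cong suc (countIf-all p pxs))

lastD-applyUpTo : ∀ x f m → lastD (x ∷ applyUpTo f (suc m)) ≡ f m
lastD-applyUpTo x f zero    = refl
lastD-applyUpTo x f (suc m) = lastD-applyUpTo (f 0) (f ∘ suc) m

applyUpTo-linked : ∀ {A : Set} {R : A → A → Set} f m → (∀ i → R (f i) (f (suc i))) →
                   Linked R (applyUpTo f m)
applyUpTo-linked f zero          _    = Linked.[]
applyUpTo-linked f (suc zero)    _    = Linked.[-]
applyUpTo-linked f (suc (suc m)) step = step 0 Linked.∷ applyUpTo-linked (f ∘ suc) (suc m) (step ∘ suc)

DeltaRisesAt : ℕ → (ℕ → ℕ) → ℕ → Set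
DeltaRisesAt N f i = δ N (f i) (f (suc i)) < δ N (f (suc i)) (f (suc (suc i)))

DeltaRisesAt-shift : ∀ N f w d → DeltaRisesAt N (λ j → f (w + j)) d → DeltaRisesAt N f (w + d)
DeltaRisesAt-shift N f w d rewrite +-suc w (suc d) | +-suc w d = λ r → r

deltas-applyUpTo-linked⁺ : ∀ N f m → (∀ {i} → 2 + i < m → DeltaRisesAt N f i) →
                           Linked _<_ (deltas N (applyUpTo f m))
deltas-applyUpTo-linked⁺ N f 0                   _     = Linked.[]
deltas-applyUpTo-linked⁺ N f 1                   _     = Linked.[]
deltas-applyUpTo-linked⁺ N f 2                   _     = Linked.[-]
deltas-applyUpTo-linked⁺ N f (suc (suc (suc m))) rises =
  rises (s≤s (s≤s (s≤s z≤n))) Linked.∷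
  deltas-applyUpTo-linked⁺ N (f ∘ suc) (suc (suc m)) (rises ∘ s≤s)

deltas-applyUpTo-linked⁻ : ∀ N f m → Linked _<_ (deltas N (applyUpTo f m)) →
                           ∀ {i} → 2 + i < m → DeltaRisesAt N f i
deltas-applyUpTo-linked⁻ N f 1                   _              (s≤s ())
deltas-applyUpTo-linked⁻ N f 2                   _              (s≤s (s≤s ()))
deltas-applyUpTo-linked⁻ N f (suc (suc (suc m))) (r Linked.∷ _) {zero}  _        = r
deltas-applyUpTo-linked⁻ N f (suc (suc (suc m))) (_ Linked.∷ l) {suc i} (s≤s lt) =
  deltas-applyUpTo-linked⁻ N (f ∘ suc) (suc (suc m)) l lt

split-of-separated :
  ∀ N z f m → 2 ≤ m →
  (∀ {i} → i < m → leafStr N z ≺ leafStr N (f i)) →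
  (∀ {i j} → i < j → j < m → leafStr N (f i) ≺ leafStr N (f j)) →
  (∀ {i j} → i < j → j < m →
     ∣lcp∣ (leafStr N z) (leafStr N (f i)) < ∣lcp∣ (leafStr N (f i)) (leafStr N (f j))) →
  ¬ Linked _<_ (deltas N (applyUpTo f m)) →
  Split N 1 m (z ∷ applyUpTo f m)
split-of-separated N z f 1 (s≤s ())
split-of-separated N z f (suc (suc m)) _ z≺f f≺f separated ¬linked =
  s≤s (s≤s (s≤s z≤n)) , ¬leftComb , ¬rightComb , sizeL , sizeR
  where
  X : List ℕ
  X = z ∷ applyUpTo f (suc (suc m))
  U : List Bool
  U = lcp (leafStr N z) (leafStr N (f (suc m)))

  ¬leftComb : ¬ LeftComb N X
  ¬leftComb (_ , (falls Linked.∷ _)) = <-asym falls (s≤s (separated (s≤s z≤n) (s≤s (s≤s z≤n))))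

  ¬rightComb : ¬ RightComb N X
  ¬rightComb (_ , (_ Linked.∷ rises)) = ¬linked rises

  uX≡U : uX N X ≡ U
  uX≡U = cong (λ v → lcp (leafStr N z) (leafStr N v)) (lastD-applyUpTo z f (suc m))

  z-left : isPrefix (U ++ [ false ]) (leafStr N z) ≡ true
  z-left = ≺⇒left-of-lcp (z≺f ≤-refl)

  f-right : ∀ {i} → i < suc (suc m) → isPrefix (U ++ [ true ]) (leafStr N (f i)) ≡ true
  f-right i<m with m≤n⇒m<n∨m≡n (s≤s⁻¹ i<m)
  ... | inj₁ i<last =
    ≺-between⇒right-of-lcp (z≺f i<m) (f≺f i<last ≤-refl) (separated i<last ≤-refl)
  ... | inj₂ refl   = ≺⇒right-of-lcp (z≺f ≤-refl)

  below : Bool → List Bool → ℕ → Bool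
  below b u x = isPrefix (u ++ [ b ]) (leafStr N x)

  sizeL : sizeXL N X ≡ 1
  sizeL = subst (λ u → countIf (below false u) X ≡ 1) (sym uX≡U)
    (trans (countIf-∷-true (below false U) z (applyUpTo f (suc (suc m))) z-left)
           (cong suc (countIf-none (below false U) (applyUpTo⁺₁ f (suc (suc m))
             (λ i<m → isPrefix-∷ʳ-exclusive U true _ (f-right i<m))))))

  sizeR : sizeXR N X ≡ suc (suc m)
  sizeR = subst (λ u → countIf (below true u) X ≡ suc (suc m)) (sym uX≡U)
    (trans (countIf-∷-false (below true U) z (applyUpTo f (suc (suc m)))
                            (isPrefix-∷ʳ-exclusive U false _ z-left))
    (trans (countIf-all (below true U) (applyUpTo⁺₁ f (suc (suc m)) f-right))
           (length-applyUpTo f (suc (suc m)))))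

window-around : ∀ {a b s n i} → s ≤ n → a + n ≤ b → a ≤ i → s + i ≤ b →
                ∃[ w ] ∃[ d ] (a ≤ w × w + n ≤ b × w + d ≡ i × s + d ≤ n)
window-around {a} {b} {s} {n} {i} s≤n a+n≤b a≤i s+i≤b with i + n ≤? b
... | yes i+n≤b = i , 0 , a≤i , i+n≤b , +-identityʳ i , subst (_≤ n) (sym (+-identityʳ s)) s≤n
... | no  i+n≰b = w , i ∸ w , a≤w , ≤-reflexive w+n≡b , m+[n∸m]≡n w≤i , s+d≤n
  where
  open ≤-Reasoning
  w : ℕ
  w = b ∸ n
  w+n≡b : w + n ≡ b
  w+n≡b = m∸n+n≡m (m+n≤o⇒n≤o a a+n≤b)
  a≤w : a ≤ w
  a≤w = +-cancelʳ-≤ n a w (subst (a + n ≤_) (sym w+n≡b) a+n≤b)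
  w≤i : w ≤ i
  w≤i = <⇒≤ (+-cancelʳ-< n w i (subst (_< i + n) (sym w+n≡b) (≰⇒> i+n≰b)))
  s+d≤n : s + (i ∸ w) ≤ n
  s+d≤n = +-cancelʳ-≤ w (s + (i ∸ w)) n (begin
    s + (i ∸ w) + w   ≡⟨ +-assoc s (i ∸ w) w ⟩
    s + (i ∸ w + w)   ≡⟨ cong (s +_) (m∸n+n≡m w≤i) ⟩
    s + i             ≤⟨ s+i≤b ⟩
    b                 ≡⟨ w+n≡b ⟨
    w + n             ≡⟨ +-comm w n ⟩
    n + w             ∎)

window-in-range : ∀ {a b w m i} → a ≤ w → w + m ≤ suc b → i < m → a ≤ w + i × w + i ≤ b
window-in-range {w = w} {i = i} a≤w w+m≤1+b i<m =
  ≤-trans a≤w (m≤m+n w i) , s≤s⁻¹ (≤-trans (+-monoʳ-< w i<m) w+m≤1+b)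

module IncreasingLeaves (N ℓ : ℕ) (y : ℕ → ℕ)
  (y-leaf : ∀ i → i ≤ ℓ → 1 ≤ y i × y i ≤ 2 ^ N)
  (y-step : ∀ i → i < ℓ → y i < y (suc i)) where

  S : ℕ → List Bool
  S i = leafStr N (y i)

  y-strictMono : ∀ {i j} → i < j → j ≤ ℓ → y i < y j
  y-strictMono {j = suc j} (s≤s i≤j) 1+j≤ℓ with m≤n⇒m<n∨m≡n i≤j
  ... | inj₁ i<j  = <-trans (y-strictMono i<j (≤-trans (n≤1+n j) 1+j≤ℓ)) (y-step j 1+j≤ℓ)
  ... | inj₂ refl = y-step j 1+j≤ℓ

  S-≺ : ∀ {i j} → i < j → j ≤ ℓ → S i ≺ S j
  S-≺ {i} {j} i<j j≤ℓ = leafStr-mono N (proj₁ (y-leaf i (≤-trans (<⇒≤ i<j) j≤ℓ)))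
                                       (y-strictMono i<j j≤ℓ) (proj₂ (y-leaf j j≤ℓ))

  leaf-≺-S : ∀ {x j} → y 0 ≤ x → x < y j → j ≤ ℓ → leafStr N x ≺ S j
  leaf-≺-S {j = j} y₀≤x x<yⱼ j≤ℓ =
    leafStr-mono N (≤-trans (proj₁ (y-leaf 0 z≤n)) y₀≤x) x<yⱼ (proj₂ (y-leaf j j≤ℓ))

  ∣lcp∣-S-narrow : ∀ {i i′ j′ j} → i ≤ i′ → i′ < j′ → j′ ≤ j → j ≤ ℓ →
                   ∣lcp∣ (S i) (S j) ≤ ∣lcp∣ (S i′) (S j′)
  ∣lcp∣-S-narrow {i} {i′} {j′} {j} i≤i′ i′<j′ j′≤j j≤ℓ = ≤-trans narrowˡ narrowʳ
    where
    i′<j : i′ < j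
    i′<j = <-≤-trans i′<j′ j′≤j
    narrowˡ : ∣lcp∣ (S i) (S j) ≤ ∣lcp∣ (S i′) (S j)
    narrowˡ with m≤n⇒m<n∨m≡n i≤i′
    ... | inj₁ i<i′ = ∣lcp∣-≺-outerʳ (S-≺ i<i′ (≤-trans (<⇒≤ i′<j) j≤ℓ)) (S-≺ i′<j j≤ℓ)
    ... | inj₂ refl = ≤-refl
    narrowʳ : ∣lcp∣ (S i′) (S j) ≤ ∣lcp∣ (S i′) (S j′)
    narrowʳ with m≤n⇒m<n∨m≡n j′≤j
    ... | inj₁ j′<j = ∣lcp∣-≺-outerˡ (S-≺ i′<j′ (≤-trans (<⇒≤ j′<j) j≤ℓ)) (S-≺ j′<j j≤ℓ)
    ... | inj₂ refl = ≤-refl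

  SplitAvoidable : ℕ → Set
  SplitAvoidable n = (J : List ℕ) → Linked _<_ J → All (λ j → 2 ≤ j × j ≤ ℓ) J → length J ≡ n →
                     ∃[ z ] (y 0 ≤ z × z ≤ y 1 × ¬ Split N 1 n (z ∷ map y J))

  skip₁ : ℕ → ℕ
  skip₁ zero    = y 0
  skip₁ (suc i) = y (suc (suc i))

  module _ (comb : ∣lcp∣ (S 1) (S 2) < ∣lcp∣ (S 2) (S ℓ)) where

    separated : ∀ {z j j′} → y 0 ≤ z → z ≤ y 1 → 2 ≤ j → j < j′ → j′ ≤ ℓ →
                ∣lcp∣ (leafStr N z) (S j) < ∣lcp∣ (S j) (S j′)
    separated {z} {j} {j′} y₀≤z z≤y₁ 2≤j j<j′ j′≤ℓ = begin-strict
      ∣lcp∣ (leafStr N z) (S j) ≤⟨ z-under-y₁ ⟩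
      ∣lcp∣ (S 1) (S j)         ≤⟨ ∣lcp∣-S-narrow ≤-refl ≤-refl 2≤j j≤ℓ ⟩
      ∣lcp∣ (S 1) (S 2)         <⟨ comb ⟩
      ∣lcp∣ (S 2) (S ℓ)         ≤⟨ ∣lcp∣-S-narrow 2≤j j<j′ j′≤ℓ ≤-refl ⟩
      ∣lcp∣ (S j) (S j′)        ∎
      where
      open ≤-Reasoning
      j≤ℓ : j ≤ ℓ
      j≤ℓ = ≤-trans (<⇒≤ j<j′) j′≤ℓ
      z-under-y₁ : ∣lcp∣ (leafStr N z) (S j) ≤ ∣lcp∣ (S 1) (S j)
      z-under-y₁ with m≤n⇒m<n∨m≡n z≤y₁
      ... | inj₁ z<y₁ = ∣lcp∣-≺-outerʳ (leaf-≺-S y₀≤z z<y₁ (≤-trans (<⇒≤ 2≤j) j≤ℓ)) (S-≺ 2≤j j≤ℓ)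
      ... | inj₂ refl = ≤-refl

    window-split : ∀ {z w m} → y 0 ≤ z → z ≤ y 1 → 2 ≤ w → w + m ≤ suc ℓ → 2 ≤ m →
                   ¬ Linked _<_ (deltas N (applyUpTo (λ i → y (w + i)) m)) →
                   Split N 1 m (z ∷ applyUpTo (λ i → y (w + i)) m)
    window-split {z} {w} {m} y₀≤z z≤y₁ 2≤w w+m≤1+ℓ 2≤m =
      split-of-separated N z (λ i → y (w + i)) m 2≤m
        (λ i<m → leaf-≺-S y₀≤z (≤-<-trans z≤y₁ (y-strictMono (2≤ i<m) (≤ℓ i<m))) (≤ℓ i<m))
        (λ i<j j<m → S-≺ (+-monoʳ-< w i<j) (≤ℓ j<m))
        (λ i<j j<m → separated y₀≤z z≤y₁ (2≤ (<-trans i<j j<m)) (+-monoʳ-< w i<j) (≤ℓ j<m))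
      where
      2≤ : ∀ {i} → i < m → 2 ≤ w + i
      2≤ = proj₁ ∘ window-in-range 2≤w w+m≤1+ℓ
      ≤ℓ : ∀ {i} → i < m → w + i ≤ ℓ
      ≤ℓ = proj₂ ∘ window-in-range 2≤w w+m≤1+ℓ

    rises : ∀ {n} → 3 ≤ n → n < ℓ → SplitAvoidable n →
            ∀ {i} → 2 ≤ i → suc i < ℓ → DeltaRisesAt N y i
    rises {n} 3≤n n<ℓ avoid {i} 2≤i 1+i<ℓ = decidable-stable (_ <? _) ¬¬rises
      where
      ¬¬rises : ¬ ¬ DeltaRisesAt N y i
      ¬¬rises ¬rises with window-around {2} {suc ℓ} {3} {n} {i} 3≤n (s≤s n<ℓ) 2≤i (s≤s 1+i<ℓ)
      ... | w , d , 2≤w , w+n≤1+ℓ , w+d≡i , 3+d≤n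
          with avoid (applyUpTo (w +_) n)
                     (applyUpTo-linked (w +_) n (λ j → +-monoʳ-< w (n<1+n j)))
                     (applyUpTo⁺₁ (w +_) n (window-in-range 2≤w w+n≤1+ℓ))
                     (length-applyUpTo (w +_) n)
      ...   | z , y₀≤z , z≤y₁ , ¬split =
        ¬split (subst (λ ys → Split N 1 n (z ∷ ys)) (sym (map-applyUpTo (w +_) y n))
                      (window-split y₀≤z z≤y₁ 2≤w w+n≤1+ℓ (≤-trans (n≤1+n 2) 3≤n) ¬linked))
        where
        ¬linked : ¬ Linked _<_ (deltas N (applyUpTo (λ j → y (w + j)) n))
        ¬linked linked = ¬rises (subst (DeltaRisesAt N y) w+d≡i
          (DeltaRisesAt-shift N y w d (deltas-applyUpTo-linked⁻ N _ n linked 3+d≤n)))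

    first-rise : 3 ≤ ℓ → DeltaRisesAt N skip₁ 0
    first-rise 3≤ℓ = s≤s (begin-strict
      ∣lcp∣ (S 0) (S 2) ≤⟨ ∣lcp∣-S-narrow z≤n ≤-refl ≤-refl (≤-trans (n≤1+n 2) 3≤ℓ) ⟩
      ∣lcp∣ (S 1) (S 2) <⟨ comb ⟩
      ∣lcp∣ (S 2) (S ℓ) ≤⟨ ∣lcp∣-S-narrow ≤-refl ≤-refl 3≤ℓ ≤-refl ⟩
      ∣lcp∣ (S 2) (S 3) ∎)
      where open ≤-Reasoning

    rightComb-skip₁ : ∀ {n} → 3 ≤ n → n < ℓ → SplitAvoidable n → RightComb N (applyUpTo skip₁ ℓ)
    rightComb-skip₁ 3≤n n<ℓ avoid =
      subst (3 ≤_) (sym (length-applyUpTo skip₁ ℓ)) 3≤ℓ ,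
      deltas-applyUpTo-linked⁺ N skip₁ ℓ skip₁-rises
      where
      3≤ℓ : 3 ≤ ℓ
      3≤ℓ = ≤-trans 3≤n (<⇒≤ n<ℓ)
      skip₁-rises : ∀ {i} → 2 + i < ℓ → DeltaRisesAt N skip₁ i
      skip₁-rises {zero}  _     = first-rise 3≤ℓ
      skip₁-rises {suc i} 3+i<ℓ = rises 3≤n n<ℓ avoid (s≤s (s≤s z≤n)) 3+i<ℓ

fact2p12 : (k ℓ N : ℕ) → 4 ≤ k → k ≤ ℓ →
    (y : ℕ → ℕ) →
    (∀ i → i ≤ ℓ → 1 ≤ y i × y i ≤ 2 ^ N) →
    (∀ i → i < ℓ → y i < y (suc i)) →
    RightComb N (y 1 ∷ y 2 ∷ y ℓ ∷ []) →
    ((J : List ℕ) → Linked _<_ J → All (λ j → 2 ≤ j × j ≤ ℓ) J → length J ≡ k ∸ 1 →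
      ∃[ z ] (y 0 ≤ z × z ≤ y 1 × ¬ Split N 1 (k ∸ 1) (z ∷ map y J))) →
    RightComb N (y 0 ∷ map (λ i → y (2 + i)) (upTo (ℓ ∸ 1)))
fact2p12 (suc n) (suc ℓ′) N 4≤k k≤ℓ y y-leaf y-step (_ , (comb Linked.∷ _)) avoid =
  subst (λ ys → RightComb N (y 0 ∷ ys)) (sym (map-upTo (λ i → y (2 + i)) ℓ′))
    (rightComb-skip₁ (s<s⁻¹ comb) (s≤s⁻¹ 4≤k) k≤ℓ avoid)
  where open IncreasingLeaves N (suc ℓ′) y y-leaf y-step
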